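{- Let $G=(V,E)$ be an undirected edge-weighted graph, let $p,v\in V$ be distinct, and let $S$ with $v\in S$, $p\notin S$ be a minimum $p,v$-cut. If $|E(\{p\},S)|>0.6\cdot\deg(p)$, then for every $v'\in(V\setminus S)\setminus\{p\}$ we have $\lambda_{p,v'}\leq 0.8\cdot\lambda_{p,v}$.
   Context: $\deg(u)$ is the weighted degree of $u$, $|E(A,B)|$ is the total weight of edges between $A$ and $B$, and $\lambda_{x,y}$ denotes the value (total crossing weight) of a minimum $x,y$-cut in $G$.
   Formalization: The edge weights of G are rational numbers, so the weighted degrees, the edge totals $|E(A,B)|$ and the cut values are rational as well. -}

module Defs where

open import Data.Nat using (ℕ; zero; suc)
open import Data.Fin using (Fin; zero; suc)
open import Data.Bool using (Bool; true; false; if_then_else_)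
open import Data.Rational using (ℚ; 0ℚ; _+_; _*_; _≤_)
open import Data.Product using (_×_)
open import Data.Fin using (_≟_)
open import Relation.Nullary using (does)
open import Relation.Binary.PropositionalEquality using (_≡_; _≢_)

Σ : (n : ℕ) → (Fin n → ℚ) → ℚ
Σ zero    f = 0ℚ
Σ (suc n) f = f zero + Σ n (λ i → f (suc i))

-- An undirected edge-weighted graph on vertex set Fin n, given by a symmetric
-- nonnegative weight function without self-loops (w i j = 0 means no edge).
record WGraph (n : ℕ) : Set where
  field
    w       : Fin n → Fin n → ℚ
    w-sym   : ∀ i j → w i j ≡ w j i
    w-nonneg : ∀ i j → 0ℚ ≤ w i j
    w-loop  : ∀ i → w i i ≡ 0ℚ
open WGraph public

VSet : ℕ → Set
VSet n = Fin n → Bool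

deg : ∀ {n} → WGraph n → Fin n → ℚ
deg {n} G u = Σ n (λ j → w G u j)

E : ∀ {n} → WGraph n → VSet n → VSet n → ℚ
E {n} G A B = Σ n (λ i → Σ n (λ j →
  if A i then (if B j then w G i j else 0ℚ) else 0ℚ))

∁ : ∀ {n} → VSet n → VSet n
∁ S i = if S i then false else true

⟦_⟧ : ∀ {n} → Fin n → VSet n
⟦_⟧ u i = does (u ≟ i)

cutValue : ∀ {n} → WGraph n → VSet n → ℚ
cutValue G S = E G S (∁ S)

-- S is an x,y-cut (convention of the paper: y ∈ S, x ∉ S)
IsCut : ∀ {n} → Fin n → Fin n → VSet n → Set
IsCut x y S = (S x ≡ false) × (S y ≡ true)

-- S is a minimum x,y-cut; then λ_{x,y} = cutValue G S
IsMinCut : ∀ {n} → WGraph n → Fin n → Fin n → VSet n → Set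
IsMinCut G x y S = IsCut x y S × (∀ T → IsCut x y T → cutValue G S ≤ cutValue G T)

{-# OPTIONS --safe #-}
module Submission where

-- Split the vertices into S, {p} and R = V ∖ (S ∪ {p}), and let a = |E({p},S)|,
-- b = |E({p},R)|, x = |E(S,R)|. Then λ_{p,v} = a + x and deg p = a + b, while R is
-- a p,v'-cut of value x + b. Comparing S with the p,v-cut V ∖ {p} gives x ≤ b, and
-- the hypothesis on p gives 3b < 2a; together x + b ≤ (4/5)(a + x).

open import Defs
open import Data.Nat using (ℕ; zero; suc)
open import Data.Fin using (Fin; zero; suc; _≟_)
open import Data.Bool using (Bool; true; false; if_then_else_; _∧_; _∨_)
open import Data.Bool.Properties using (∧-zeroʳ)
open import Data.Integer using (+_)
open import Data.Rational using (ℚ; 0ℚ; _/_; _+_; _*_; -_; _<_; _≤_)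
open import Data.Rational.Properties
  using ( +-identityˡ; +-identityʳ; +-inverseʳ; +-mono-≤; +-monoˡ-≤; +-monoʳ-≤
        ; *-monoˡ-≤-nonNeg; <⇒≤; module ≤-Reasoning; +-0-commutativeMonoid )
open import Data.Rational.Solver using (module +-*-Solver)
open import Algebra.Properties.CommutativeMonoid.Sum +-0-commutativeMonoid
  using (sum; sum-cong-≗; sum-replicate-zero; ∑-distrib-+; ∑-comm)
open import Data.Product using (_,_)
open import Function using (_∘_)
open import Relation.Nullary using (yes; no)
open import Relation.Nullary.Decidable using (dec-true; dec-false)
open import Relation.Binary.PropositionalEquality
  using (_≡_; _≢_; _≗_; refl; sym; trans; cong; cong₂; subst; subst₂; module ≡-Reasoning)

Σ≡sum : ∀ n (f : Fin n → ℚ) → Σ n f ≡ sum f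
Σ≡sum zero    f = refl
Σ≡sum (suc n) f = cong (_+_ (f zero)) (Σ≡sum n (f ∘ suc))

Σ-cong : ∀ n {f g : Fin n → ℚ} → f ≗ g → Σ n f ≡ Σ n g
Σ-cong zero    f≗g = refl
Σ-cong (suc n) f≗g = cong₂ _+_ (f≗g zero) (Σ-cong n (f≗g ∘ suc))

Σ-zero : ∀ n → Σ n (λ _ → 0ℚ) ≡ 0ℚ
Σ-zero n = trans (Σ≡sum n _) (sum-replicate-zero n)

Σ-distrib-+ : ∀ n (f g : Fin n → ℚ) → Σ n (λ i → f i + g i) ≡ Σ n f + Σ n g
Σ-distrib-+ n f g = begin
  Σ n (λ i → f i + g i) ≡⟨ Σ≡sum n _ ⟩
  sum (λ i → f i + g i) ≡⟨ ∑-distrib-+ f g ⟩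
  sum f + sum g         ≡⟨ sym (cong₂ _+_ (Σ≡sum n f) (Σ≡sum n g)) ⟩
  Σ n f + Σ n g         ∎
  where open ≡-Reasoning

Σ-comm : ∀ m n (f : Fin m → Fin n → ℚ) →
  Σ m (λ i → Σ n (f i)) ≡ Σ n (λ j → Σ m (λ i → f i j))
Σ-comm m n f = begin
  Σ m (λ i → Σ n (f i))               ≡⟨ double m n f ⟩
  sum (λ i → sum (f i))               ≡⟨ ∑-comm f ⟩
  sum (λ j → sum (λ i → f i j))       ≡⟨ sym (double n m (λ j i → f i j)) ⟩
  Σ n (λ j → Σ m (λ i → f i j))       ∎
  where
  open ≡-Reasoning
  double : ∀ m n (g : Fin m → Fin n → ℚ) → Σ m (λ i → Σ n (g i)) ≡ sum (λ i → sum (g i))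
  double m n g = trans (Σ≡sum m _) (sum-cong-≗ (λ i → Σ≡sum n (g i)))

-- E G A B unfolds to Σ i Σ j mask (A i) (mask (B j) (w G i j)).
mask : Bool → ℚ → ℚ
mask b x = if b then x else 0ℚ

mask-distrib-+ : ∀ b x y → mask b (x + y) ≡ mask b x + mask b y
mask-distrib-+ true  x y = refl
mask-distrib-+ false x y = refl

mask-complement : ∀ b x → mask b x + mask (if b then false else true) x ≡ x
mask-complement true  x = +-identityʳ x
mask-complement false x = +-identityˡ x

⟦⟧-self : ∀ {n} (p : Fin n) → ⟦ p ⟧ p ≡ true
⟦⟧-self p = dec-true (p ≟ p) refl

⟦⟧-other : ∀ {n} {p q : Fin n} → p ≢ q → ⟦ p ⟧ q ≡ false
⟦⟧-other {p = p} {q} = dec-false (p ≟ q)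

Σ-mask-singleton : ∀ n (p : Fin n) (g : Fin n → ℚ) → Σ n (λ j → mask (⟦ p ⟧ j) (g j)) ≡ g p
Σ-mask-singleton (suc n) zero g =
  trans (cong (_+_ (g zero)) (Σ-zero n)) (+-identityʳ (g zero))
Σ-mask-singleton (suc n) (suc p) g =
  trans (cong (_+_ 0ℚ) (trans (Σ-cong n shift) (Σ-mask-singleton n p (g ∘ suc)))) (+-identityˡ _)
  where
  shift : ∀ i → mask (⟦ suc p ⟧ (suc i)) (g (suc i)) ≡ mask (⟦ p ⟧ i) (g (suc i))
  shift i with p ≟ i
  ... | yes _ = refl
  ... | no _  = refl

data OneOf₃ : Bool → Bool → Bool → Set where
  1st : OneOf₃ true false false
  2nd : OneOf₃ false true false
  3rd : OneOf₃ false false true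

Partition₃ : ∀ {n} → VSet n → VSet n → VSet n → Set
Partition₃ A B C = ∀ i → OneOf₃ (A i) (B i) (C i)

module _ {n : ℕ} {A B C : VSet n} where

  partition₃-rotate : Partition₃ A B C → Partition₃ B C A
  partition₃-rotate part i with A i | B i | C i | part i
  ... | _ | _ | _ | 1st = 3rd
  ... | _ | _ | _ | 2nd = 1st
  ... | _ | _ | _ | 3rd = 2nd

  mask-∁-partition₃ : Partition₃ A B C → ∀ i x → mask (∁ A i) x ≡ mask (B i) x + mask (C i) x
  mask-∁-partition₃ part i x with A i | B i | C i | part i
  ... | _ | _ | _ | 1st = refl
  ... | _ | _ | _ | 2nd = sym (+-identityʳ x)
  ... | _ | _ | _ | 3rd = sym (+-identityˡ x)

disjoint⇒partition₃ : ∀ {n} {A B : VSet n} → (∀ i → A i ∧ B i ≡ false) →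
  Partition₃ A B (∁ (λ i → A i ∨ B i))
disjoint⇒partition₃ {A = A} {B} disjoint i with A i | B i | disjoint i
... | true  | false | _  = 1st
... | false | true  | _  = 2nd
... | false | false | _  = 3rd
... | true  | true  | ()

disjoint-singleton : ∀ {n} {A : VSet n} {p : Fin n} → A p ≡ false → ∀ i → A i ∧ ⟦ p ⟧ i ≡ false
disjoint-singleton {A = A} {p} Ap≡false i with p ≟ i
... | yes refl rewrite Ap≡false = refl
... | no _     = ∧-zeroʳ (A i)

module _ {n : ℕ} (G : WGraph n) where

  E-congʳ : ∀ {A B B′ : VSet n} → B ≗ B′ → E G A B ≡ E G A B′
  E-congʳ {A} B≗B′ = Σ-cong n (λ i → Σ-cong n (λ j → cong (λ b → mask (A i) (mask b (w G i j))) (B≗B′ j)))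

  E-sym : ∀ (A B : VSet n) → E G A B ≡ E G B A
  E-sym A B = trans (Σ-comm n n _) (Σ-cong n (λ j → Σ-cong n (λ i → swap (A i) (B j) i j)))
    where
    swap : ∀ a b i j → mask a (mask b (w G i j)) ≡ mask b (mask a (w G j i))
    swap true  true  i j = w-sym G i j
    swap true  false i j = refl
    swap false true  i j = refl
    swap false false i j = refl

  E-splitʳ : ∀ {A B B₁ B₂ : VSet n} → (∀ j x → mask (B j) x ≡ mask (B₁ j) x + mask (B₂ j) x) →
    E G A B ≡ E G A B₁ + E G A B₂
  E-splitʳ {A} {B} {B₁} {B₂} split = begin
    Σ n (λ i → Σ n (λ j → mask (A i) (mask (B j) (w G i j))))
      ≡⟨ Σ-cong n (λ i → Σ-cong n (λ j → cong (mask (A i)) (split j (w G i j)))) ⟩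
    Σ n (λ i → Σ n (λ j → mask (A i) (mask (B₁ j) (w G i j) + mask (B₂ j) (w G i j))))
      ≡⟨ Σ-cong n (λ i → Σ-cong n (λ j → mask-distrib-+ (A i) _ _)) ⟩
    Σ n (λ i → Σ n (λ j → mask (A i) (mask (B₁ j) (w G i j)) + mask (A i) (mask (B₂ j) (w G i j))))
      ≡⟨ Σ-cong n (λ i → Σ-distrib-+ n _ _) ⟩
    Σ n (λ i → Σ n (λ j → mask (A i) (mask (B₁ j) (w G i j))) + Σ n (λ j → mask (A i) (mask (B₂ j) (w G i j))))
      ≡⟨ Σ-distrib-+ n _ _ ⟩
    E G A B₁ + E G A B₂ ∎
    where open ≡-Reasoning

  cutValue-partition₃ : ∀ {A B C : VSet n} → Partition₃ A B C → cutValue G A ≡ E G A B + E G A C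
  cutValue-partition₃ {A} part = E-splitʳ {A} (mask-∁-partition₃ part)

  cutValue-∁ : ∀ (A : VSet n) → cutValue G (∁ A) ≡ cutValue G A
  cutValue-∁ A = trans (E-congʳ {∁ A} ∁-involutive) (E-sym (∁ A) A)
    where
    ∁-involutive : ∁ (∁ A) ≗ A
    ∁-involutive i with A i
    ... | true  = refl
    ... | false = refl

  E-singletonˡ : ∀ (p : Fin n) (B : VSet n) → E G ⟦ p ⟧ B ≡ Σ n (λ j → mask (B j) (w G p j))
  E-singletonˡ p B =
    trans (Σ-comm n n _) (Σ-cong n (λ j → Σ-mask-singleton n p (λ i → mask (B j) (w G i j))))

  deg≡cutValue-singleton : ∀ (p : Fin n) → deg G p ≡ cutValue G ⟦ p ⟧
  deg≡cutValue-singleton p = begin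
    Σ n (w G p)
      ≡⟨ Σ-cong n (λ j → sym (mask-complement (⟦ p ⟧ j) (w G p j))) ⟩
    Σ n (λ j → mask (⟦ p ⟧ j) (w G p j) + mask (∁ ⟦ p ⟧ j) (w G p j))
      ≡⟨ Σ-distrib-+ n _ _ ⟩
    Σ n (λ j → mask (⟦ p ⟧ j) (w G p j)) + Σ n (λ j → mask (∁ ⟦ p ⟧ j) (w G p j))
      ≡⟨ cong (_+ Σ n (λ j → mask (∁ ⟦ p ⟧ j) (w G p j))) (trans (Σ-mask-singleton n p (w G p)) (w-loop G p)) ⟩
    0ℚ + Σ n (λ j → mask (∁ ⟦ p ⟧ j) (w G p j))
      ≡⟨ +-identityˡ _ ⟩
    Σ n (λ j → mask (∁ ⟦ p ⟧ j) (w G p j))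
      ≡⟨ sym (E-singletonˡ p (∁ ⟦ p ⟧)) ⟩
    cutValue G ⟦ p ⟧ ∎
    where open ≡-Reasoning

-- The conclusion is twice the first hypothesis plus a fifth of the second.
x+b≤⅘[a+x] : ∀ a b x → (+ 3 / 5) * (b + a) < a → a + x ≤ b + a → x + b ≤ (+ 4 / 5) * (a + x)
x+b≤⅘[a+x] a b x dense min = begin
  x + b                    ≡⟨ regroup ⟩
  ⅘ * (a + x) + (L + - R)  ≤⟨ +-monoʳ-≤ (⅘ * (a + x)) (+-monoˡ-≤ (- R) L≤R) ⟩
  ⅘ * (a + x) + (R + - R)  ≡⟨ cancel ⟩
  ⅘ * (a + x)              ∎
  where
  open ≤-Reasoning
  open +-*-Solver using (solve; _:+_; _:*_; :-_; _:=_; con)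
  ⅗ ⅘ ⅕ L R : ℚ
  ⅗ = + 3 / 5
  ⅘ = + 4 / 5
  ⅕ = + 1 / 5
  L = (⅗ * (b + a) + ⅗ * (b + a)) + ⅕ * (a + x)
  R = (a + a) + ⅕ * (b + a)
  L≤R : L ≤ R
  L≤R = +-mono-≤ (+-mono-≤ (<⇒≤ dense) (<⇒≤ dense)) (*-monoˡ-≤-nonNeg ⅕ min)
  regroup : x + b ≡ ⅘ * (a + x) + (L + - R)
  regroup = solve 3 (λ a b x → x :+ b := con ⅘ :* (a :+ x) :+
    (((con ⅗ :* (b :+ a) :+ con ⅗ :* (b :+ a)) :+ con ⅕ :* (a :+ x)) :+ :- ((a :+ a) :+ con ⅕ :* (b :+ a))))
    refl a b x
  cancel : ⅘ * (a + x) + (R + - R) ≡ ⅘ * (a + x)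
  cancel = trans (cong (_+_ (⅘ * (a + x))) (+-inverseʳ R)) (+-identityʳ _)

lemma4p5 : ∀ {n} (G : WGraph n) (p v : Fin n) (S : VSet n) →
    p ≢ v →
    IsMinCut G p v S →
    (+ 3 / 5) * deg G p < E G ⟦ p ⟧ S →
    ∀ (v' : Fin n) → S v' ≡ false → v' ≢ p →
    ∀ (T : VSet n) → IsMinCut G p v' T →
    cutValue G T ≤ (+ 4 / 5) * cutValue G S
lemma4p5 G p v S p≢v ((Sp , _) , S-min) dense v' Sv' v'≢p T (_ , T-min) = begin
  cutValue G T            ≤⟨ T-min R R-cut ⟩
  cutValue G R            ≡⟨ cut-R ⟩
  x + b                   ≤⟨ x+b≤⅘[a+x] a b x (subst (λ d → (+ 3 / 5) * d < a) deg-p dense) S≤P̅ ⟩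
  (+ 4 / 5) * (a + x)     ≡⟨ cong ((+ 4 / 5) *_) (sym cut-S) ⟩
  (+ 4 / 5) * cutValue G S ∎
  where
  open ≤-Reasoning
  P R : VSet _
  P = ⟦ p ⟧
  R = ∁ (λ i → S i ∨ P i)
  SPR : Partition₃ S P R
  SPR = disjoint⇒partition₃ (disjoint-singleton {A = S} Sp)
  a b x : ℚ
  a = E G P S
  b = E G P R
  x = E G S R
  cut-S : cutValue G S ≡ a + x
  cut-S = trans (cutValue-partition₃ G SPR) (cong (_+ x) (E-sym G S P))
  cut-P : cutValue G P ≡ b + a
  cut-P = cutValue-partition₃ G (partition₃-rotate SPR)
  cut-R : cutValue G R ≡ x + b
  cut-R = trans (cutValue-partition₃ G (partition₃-rotate (partition₃-rotate SPR)))
                (cong₂ _+_ (E-sym G R S) (E-sym G R P))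
  deg-p : deg G p ≡ b + a
  deg-p = trans (deg≡cutValue-singleton G p) cut-P
  P̅-cut : IsCut p v (∁ P)
  P̅-cut rewrite ⟦⟧-self p | ⟦⟧-other p≢v = refl , refl
  S≤P̅ : a + x ≤ b + a
  S≤P̅ = subst₂ _≤_ cut-S (trans (cutValue-∁ G P) cut-P) (S-min (∁ P) P̅-cut)
  R-cut : IsCut p v' R
  R-cut rewrite Sp | ⟦⟧-self p | Sv' | ⟦⟧-other (v'≢p ∘ sym) = refl , refl
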